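{- Let $n\ge 1$ and let $K_n$ be the complete graph on vertex set $\{1,\dots,n\}$. The number of square-free words over $\{1,\dots,n\}$ that represent $K_n$ is $n\cdot n!$.
   Context: A word $w$ over the alphabet $V$ represents the simple graph $G=(V,E)$ if every letter of $V$ occurs in $w$ and, for all distinct $x,y\in V$, $x$ and $y$ alternate in $w$ (deleting all other letters leaves $xyxy\cdots$ or $yxyx\cdots$) if and only if $xy\in E$. A square is a factor $XX$ with $X$ non-empty; a word is square-free if it contains no square. -}

module Defs where

open import Data.Nat using (ℕ)
open import Data.Fin using (Fin; _≟_)
open import Data.List using (List; []; _∷_; _++_; filter)
open import Data.List.Membership.Propositional using (_∈_)
open import Data.Product using (∃; ∃-syntax; _×_)
open import Data.Sum using (_⊎_)
open import Relation.Nullary using (¬_)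
open import Relation.Binary.PropositionalEquality using (_≡_; _≢_)
open import Relation.Nullary.Decidable using (_⊎-dec_)

Word : ℕ → Set
Word n = List (Fin n)

data NoRepeat {n : ℕ} : Word n → Set where
  nr[]  : NoRepeat []
  nr[_] : ∀ a → NoRepeat (a ∷ [])
  nr∷   : ∀ {a b w} → a ≢ b → NoRepeat (b ∷ w) → NoRepeat (a ∷ b ∷ w)

restrict : ∀ {n} → Fin n → Fin n → Word n → Word n
restrict x y = filter (λ z → (z ≟ x) ⊎-dec (z ≟ y))

-- x and y alternate in w: deleting all other letters leaves xyxy... or yxyx...
-- (for x ≠ y this is exactly: the restriction has no two consecutive equal letters)
Alternate : ∀ {n} → Fin n → Fin n → Word n → Set
Alternate x y w = NoRepeat (restrict x y w)

Represents : ∀ {n} → (E : Fin n → Fin n → Set) → Word n → Set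
Represents {n} E w =
  (∀ (x : Fin n) → x ∈ w) ×
  (∀ (x y : Fin n) → x ≢ y → (Alternate x y w → E x y) × (E x y → Alternate x y w))

Complete : ∀ {n} → Fin n → Fin n → Set
Complete x y = x ≢ y

HasSquare : ∀ {n} → Word n → Set
HasSquare {n} w = ∃[ u ] ∃[ X ] ∃[ v ] (X ≢ [] × w ≡ u ++ (X ++ (X ++ v)))

SquareFree : ∀ {n} → Word n → Set
SquareFree w = ¬ HasSquare w

module Submission where

-- The square-free words representing Kₙ are exactly the words p ++ take k p with p a
-- permutation of the alphabet and k < n, and distinct pairs (p, k) give distinct words.
-- The key fact: if a letter d recurs with no y in between, then d and y do not alternate.
-- Such a word is alternating since its restriction to {x, y} is ab followed by a prefix of ab;
-- it is square-free since, by the key fact, in a square XX the factor X contains every letter,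
-- so |XX| ≥ 2n > n + k. Conversely, let p be the longest prefix of w without repeated letters.
-- The key fact shows that p contains every letter and that each further letter of w is the
-- first letter of the current rotation of p, so w = p ++ take k p; and k = n would be a square.

open import Defs
open import Data.Nat using (ℕ; zero; suc; _*_; _+_; _≤_; _<_; _!; z≤n; s≤s)
open import Data.Nat.Properties
  using (≤-refl; ≤-reflexive; ≤-trans; ≤-antisym; <-≤-trans; ≤-<-trans; <-irrefl; <⇒≤;
         suc-injective; m≤n⇒m⊓n≡m; m<1+n⇒m<n∨m≡n; *-comm; +-mono-≤; +-monoʳ-≤; +-monoʳ-<;
         m≤m+n; m≤n+m; module ≤-Reasoning)
open import Data.Fin using (Fin; zero; _≟_)
open import Data.List
  using (List; []; _∷_; _++_; _∷ʳ_; [_]; filter; length; map; concatMap; take; drop;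
         allFin; upTo; cartesianProduct)
open import Data.List.Properties
  using (length-++; length-map; length-tabulate; length-take; length-upTo; take++drop≡id;
         take-all; ++-identityʳ; ++-assoc; ∷ʳ-++; ++-cancelˡ; ∷-injectiveˡ; ∷-injectiveʳ;
         filter-notAll; filter-++; filter-accept)
open import Data.List.Membership.Propositional using (_∈_; _∉_; find; lose)
open import Data.List.Membership.Propositional.Properties
  using (∈-filter⁺; ∈-filter⁻; ∈-++⁻; ∈-++⁺ˡ; ∈-++⁺ʳ; ∈-map⁺; ∈-map⁻; ∈-concatMap⁺;
         ∈-concatMap⁻; ∈-allFin; ∈-length; ∈-upTo⁺; ∈-upTo⁻; ∈-cartesianProduct⁺;
         ∈-cartesianProduct⁻)
import Data.List.Membership.DecPropositional as DecMembership
open import Data.List.Relation.Binary.Subset.Propositional using (_⊆_)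
open import Data.List.Relation.Binary.Disjoint.Propositional using (Disjoint)
open import Data.List.Relation.Unary.Any using (here; there)
import Data.List.Relation.Unary.Any as Any
open import Data.List.Relation.Unary.All using (All; []; _∷_)
import Data.List.Relation.Unary.All as All
import Data.List.Relation.Unary.All.Properties as All
open import Data.List.Relation.Unary.AllPairs using ([]; _∷_)
import Data.List.Relation.Unary.AllPairs as AllPairs
import Data.List.Relation.Unary.AllPairs.Properties as AllPairs
open import Data.List.Relation.Unary.Unique.Propositional using (Unique)
import Data.List.Relation.Unary.Unique.Propositional.Properties as Unique
open import Data.Product using (Σ; ∃; ∃₂; _×_; _,_; proj₁; proj₂; uncurry)
open import Data.Sum using (inj₁; inj₂)
open import Data.Empty using (⊥-elim)
open import Function using (_∘_; id; case_of_)
open import Function.Bundles using (_⇔_; mk⇔; Equivalence)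
import Function.Properties.Equivalence as ⇔
open import Relation.Nullary using (¬_; yes; no; ¬?)
open import Relation.Nullary.Decidable using (_⊎-dec_)
open import Relation.Binary.Definitions using (DecidableEquality)
open import Relation.Binary.PropositionalEquality
  using (_≡_; _≢_; refl; sym; trans; cong; cong₂; subst; module ≡-Reasoning)

module _ {A : Set} where

  length-concatMap : ∀ {B : Set} (f : A → List B) {k} xs →
    (∀ {x} → x ∈ xs → length (f x) ≡ k) → length (concatMap f xs) ≡ length xs * k
  length-concatMap f []       _   = refl
  length-concatMap f (x ∷ xs) len = trans (length-++ (f x))
    (cong₂ _+_ (len (here refl)) (length-concatMap f xs (len ∘ there)))

  Unique-map⁺-∈ : ∀ {B : Set} {f : A → B} {xs} →
    (∀ {x y} → x ∈ xs → y ∈ xs → f x ≡ f y → x ≡ y) → Unique xs → Unique (map f xs)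
  Unique-map⁺-∈ {xs = []}     _   []            = []
  Unique-map⁺-∈ {xs = x ∷ xs} inj (x∉xs ∷ u) =
    All.map⁺ (All.tabulate λ y∈xs fx≡fy → All.lookup x∉xs y∈xs (inj (here refl) (there y∈xs) fx≡fy))
    ∷ Unique-map⁺-∈ (λ x∈ y∈ → inj (there x∈) (there y∈)) u

  length-cartesianProduct : ∀ {B : Set} (xs : List A) (ys : List B) →
    length (cartesianProduct xs ys) ≡ length xs * length ys
  length-cartesianProduct []       ys = refl
  length-cartesianProduct (x ∷ xs) ys = trans (length-++ (map (x ,_) ys))
    (cong₂ _+_ (length-map (x ,_) ys) (length-cartesianProduct xs ys))

  ++-cancelˡ-length : ∀ (xs ys : List A) {zs ws} → length xs ≡ length ys → xs ++ zs ≡ ys ++ ws → xs ≡ ys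
  ++-cancelˡ-length []       []       _   _  = refl
  ++-cancelˡ-length (x ∷ xs) (y ∷ ys) len eq =
    cong₂ _∷_ (∷-injectiveˡ eq) (++-cancelˡ-length xs ys (suc-injective len) (∷-injectiveʳ eq))

  length-∷ʳ : ∀ (xs : List A) x → length (xs ∷ʳ x) ≡ suc (length xs)
  length-∷ʳ []       _ = refl
  length-∷ʳ (_ ∷ xs) x = cong suc (length-∷ʳ xs x)

  take-++ˡ : ∀ (xs : List A) {ys k} → k ≤ length xs → take k (xs ++ ys) ≡ take k xs
  take-++ˡ xs       {k = zero}  _         = refl
  take-++ˡ (x ∷ xs) {k = suc k} (s≤s k≤xs) = cong (x ∷_) (take-++ˡ xs k≤xs)

  Unique-∷ʳ : ∀ {x : A} {xs} → x ∉ xs → Unique xs → Unique (xs ∷ʳ x)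
  Unique-∷ʳ x∉xs u = Unique.++⁺ u ([] ∷ []) λ { (x∈xs , here refl) → x∉xs x∈xs }

module WithDecidableEquality {A : Set} (_≟ᴬ_ : DecidableEquality A) where

  open DecMembership _≟ᴬ_ public using (_∈?_)

  remove : A → List A → List A
  remove x = filter (λ y → ¬? (y ≟ᴬ x))

  ∈-remove⁺ : ∀ {x y xs} → y ∈ xs → y ≢ x → y ∈ remove x xs
  ∈-remove⁺ {x} = ∈-filter⁺ (λ y → ¬? (y ≟ᴬ x))

  ∈-remove⁻ : ∀ {x y} xs → y ∈ remove x xs → y ∈ xs × y ≢ x
  ∈-remove⁻ {x} xs = ∈-filter⁻ (λ y → ¬? (y ≟ᴬ x)) {xs = xs}

  ⊆-∷-remove : ∀ {x} xs → xs ⊆ x ∷ remove x xs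
  ⊆-∷-remove {x} xs {y} y∈xs with y ≟ᴬ x
  ... | yes refl = here refl
  ... | no  y≢x  = there (∈-remove⁺ y∈xs y≢x)

  length-remove< : ∀ {x xs} → x ∈ xs → length (remove x xs) < length xs
  length-remove< {x} {xs} x∈xs =
    filter-notAll (λ y → ¬? (y ≟ᴬ x)) xs (Any.map (λ x≡y y≢x → y≢x (sym x≡y)) x∈xs)

  Unique-⊆⇒length≤ : ∀ {xs ys} → Unique xs → xs ⊆ ys → length xs ≤ length ys
  Unique-⊆⇒length≤ {[]}     _            _     = z≤n
  Unique-⊆⇒length≤ {x ∷ xs} {ys} (x∉xs ∷ u) xs⊆ys =
    ≤-trans (s≤s (Unique-⊆⇒length≤ u xs⊆remove)) (length-remove< (xs⊆ys (here refl)))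
    where
    xs⊆remove : xs ⊆ remove x ys
    xs⊆remove y∈xs = ∈-remove⁺ (xs⊆ys (there y∈xs)) λ { refl → All.lookup x∉xs y∈xs refl }

  length-remove : ∀ {x xs} → Unique xs → x ∈ xs → length xs ≡ suc (length (remove x xs))
  length-remove {xs = xs} u x∈xs = ≤-antisym (Unique-⊆⇒length≤ u (⊆-∷-remove xs)) (length-remove< x∈xs)

  Unique-⊆-length⇒⊇ : ∀ {xs ys} → Unique xs → xs ⊆ ys → length ys ≤ length xs → ys ⊆ xs
  Unique-⊆-length⇒⊇ {xs} {ys} u xs⊆ys ys≤xs {y} y∈ys with y ∈? xs
  ... | yes y∈xs = y∈xs
  ... | no  y∉xs =
    ⊥-elim (<-irrefl refl (≤-<-trans xs≤remove (<-≤-trans (length-remove< y∈ys) ys≤xs)))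
    where
    xs≤remove : length xs ≤ length (remove y ys)
    xs≤remove = Unique-⊆⇒length≤ u λ z∈xs → ∈-remove⁺ (xs⊆ys z∈xs) λ { refl → y∉xs z∈xs }

  arrangements : ℕ → List A → List (List A)
  arrangements zero    xs = [ [] ]
  arrangements (suc m) xs = concatMap (λ x → map (x ∷_) (arrangements m (remove x xs))) xs

  ∈-arrangements⁻ : ∀ m {xs p} → p ∈ arrangements m xs → Unique p × p ⊆ xs × length p ≡ m
  ∈-arrangements⁻ zero (here refl) = [] , (λ ()) , refl
  ∈-arrangements⁻ (suc m) {xs} p∈
    with x , x∈xs , p∈′ ← find (∈-concatMap⁻ _ {xs = xs} p∈)
    with q , q∈ , refl ← ∈-map⁻ (x ∷_) p∈′
    with uq , q⊆ , refl ← ∈-arrangements⁻ m q∈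
    = All.tabulate (λ z∈q x≡z → proj₂ (∈-remove⁻ xs (q⊆ z∈q)) (sym x≡z)) ∷ uq
    , (λ { (here refl) → x∈xs ; (there z∈q) → proj₁ (∈-remove⁻ xs (q⊆ z∈q)) })
    , refl

  ∈-arrangements⁺ : ∀ m {xs p} → Unique p → p ⊆ xs → length p ≡ m → p ∈ arrangements m xs
  ∈-arrangements⁺ zero    {p = []}    _            _    _    = here refl
  ∈-arrangements⁺ (suc m) {xs} {x ∷ q} (x∉q ∷ uq) p⊆xs refl =
    ∈-concatMap⁺ _ (lose (p⊆xs (here refl)) (∈-map⁺ (x ∷_) (∈-arrangements⁺ m uq q⊆remove refl)))
    where
    q⊆remove : q ⊆ remove x xs
    q⊆remove z∈q = ∈-remove⁺ (p⊆xs (there z∈q)) λ { refl → All.lookup x∉q z∈q refl }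

  Unique-arrangements : ∀ m {xs} → Unique xs → Unique (arrangements m xs)
  Unique-arrangements zero    _ = [] ∷ []
  Unique-arrangements (suc m) {xs} u = Unique.concat⁺
    (All.map⁺ (All.tabulate λ {x} _ →
      Unique.map⁺ ∷-injectiveʳ (Unique-arrangements m {remove x xs} (Unique.filter⁺ _ u))))
    (AllPairs.map⁺ (AllPairs.map differentHeads u))
    where
    differentHeads : ∀ {x y} {ps qs : List (List A)} → x ≢ y → Disjoint (map (x ∷_) ps) (map (y ∷_) qs)
    differentHeads x≢y (v∈ps , v∈qs)
      with _ , _ , refl ← ∈-map⁻ _ v∈ps
      with _ , _ , refl ← ∈-map⁻ _ v∈qs = x≢y refl

  length-arrangements : ∀ m {xs} → Unique xs → length xs ≡ m → length (arrangements m xs) ≡ m !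
  length-arrangements zero    _ _  = refl
  length-arrangements (suc m) {xs} u eq = trans
    (length-concatMap _ xs λ {x} x∈xs → trans (length-map (x ∷_) (arrangements m (remove x xs)))
      (length-arrangements m {remove x xs} (Unique.filter⁺ _ u)
        (suc-injective (trans (sym (length-remove u x∈xs)) eq))))
    (cong (_* m !) eq)

  maximalUniquePrefix : ∀ w → ∃₂ λ p s → w ≡ p ++ s × Unique p × (∀ {d s′} → s ≡ d ∷ s′ → d ∈ p)
  maximalUniquePrefix w = extend [] w []
    where
    extend : ∀ acc w → Unique acc →
      ∃₂ λ p s → acc ++ w ≡ p ++ s × Unique p × (∀ {d s′} → s ≡ d ∷ s′ → d ∈ p)
    extend acc []      u = acc , [] , refl , u , λ ()
    extend acc (c ∷ w) u with c ∈? acc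
    ... | yes c∈acc = acc , c ∷ w , refl , u , λ { refl → c∈acc }
    ... | no  c∉acc with p , s , eq , rest ← extend (acc ∷ʳ c) w (Unique-∷ʳ c∉acc u)
      = p , s , trans (sym (++-assoc acc [ c ] w)) eq , rest

open module FinDecEq {n} = WithDecidableEquality (_≟_ {n})
  using (_∈?_; Unique-⊆⇒length≤; Unique-⊆-length⇒⊇; arrangements; ∈-arrangements⁻; ∈-arrangements⁺;
         Unique-arrangements; length-arrangements; maximalUniquePrefix)

length-allFin : ∀ n → length (allFin n) ≡ n
length-allFin n = length-tabulate id

IsPermutation : ∀ {n} → Word n → Set
IsPermutation {n} p = Unique p × (∀ (x : Fin n) → x ∈ p)

permutations : ∀ n → List (Word n)
permutations n = arrangements n (allFin n)

IsPermutation⇒length≡ : ∀ {n} {p : Word n} → IsPermutation p → length p ≡ n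
IsPermutation⇒length≡ {n} (up , covers) = ≤-antisym
  (≤-trans (Unique-⊆⇒length≤ up (λ {x} _ → ∈-allFin x)) (≤-reflexive (length-allFin n)))
  (≤-trans (≤-reflexive (sym (length-allFin n))) (Unique-⊆⇒length≤ (Unique.allFin⁺ n) (λ {x} _ → covers x)))

∈-permutations⇔ : ∀ {n} {p : Word n} → p ∈ permutations n ⇔ IsPermutation p
∈-permutations⇔ {n} = mk⇔ to from
  where
  to : ∀ {p} → p ∈ permutations n → IsPermutation p
  to p∈ with up , _ , len ← ∈-arrangements⁻ n p∈ =
    up , λ x → Unique-⊆-length⇒⊇ up (λ {x} _ → ∈-allFin x)
                 (≤-reflexive (trans (length-allFin n) (sym len))) (∈-allFin x)
  from : ∀ {p} → IsPermutation p → p ∈ permutations n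
  from perm = ∈-arrangements⁺ n (proj₁ perm) (λ {x} _ → ∈-allFin x) (IsPermutation⇒length≡ perm)

∈-permutations⇒length≡ : ∀ {n} {p : Word n} → p ∈ permutations n → length p ≡ n
∈-permutations⇒length≡ = IsPermutation⇒length≡ ∘ Equivalence.to ∈-permutations⇔

Unique-permutations : ∀ n → Unique (permutations n)
Unique-permutations n = Unique-arrangements n (Unique.allFin⁺ n)

length-permutations : ∀ n → length (permutations n) ≡ n !
length-permutations n = length-arrangements n (Unique.allFin⁺ n) (length-allFin n)

Alternating : ∀ {n} → Word n → Set
Alternating {n} w = ∀ (x y : Fin n) → x ≢ y → Alternate x y w

restrict-++ : ∀ {n} (x y : Fin n) u v → restrict x y (u ++ v) ≡ restrict x y u ++ restrict x y v
restrict-++ x y = filter-++ (λ z → (z ≟ x) ⊎-dec (z ≟ y))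

restrict-∷ˡ : ∀ {n} (x y : Fin n) w → restrict x y (x ∷ w) ≡ x ∷ restrict x y w
restrict-∷ˡ x y w = filter-accept (λ z → (z ≟ x) ⊎-dec (z ≟ y)) (inj₁ refl)

NoRepeat-suffix : ∀ {n} (u : Word n) {v} → NoRepeat (u ++ v) → NoRepeat v
NoRepeat-suffix []          nr              = nr
NoRepeat-suffix (_ ∷ [])    nr[ _ ]         = nr[]
NoRepeat-suffix (_ ∷ [])    (nr∷ _ nr)      = nr
NoRepeat-suffix (_ ∷ b ∷ u) (nr∷ _ nr)      = NoRepeat-suffix (b ∷ u) nr

Alternating-suffix : ∀ {n} (u : Word n) {v} → Alternating (u ++ v) → Alternating v
Alternating-suffix u {v} alt x y x≢y =
  NoRepeat-suffix (restrict x y u) (subst NoRepeat (restrict-++ x y u v) (alt x y x≢y))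

SquareFree-suffix : ∀ {n} (u : Word n) {v} → SquareFree (u ++ v) → SquareFree v
SquareFree-suffix u sf (u′ , X , v′ , X≢[] , refl) = sf (u ++ u′ , X , v′ , X≢[] , sym (++-assoc u u′ _))

¬NoRepeat-run : ∀ {n} {d : Fin n} {r m} → All (_≡ d) r → d ∈ r → ¬ NoRepeat (r ++ d ∷ m)
¬NoRepeat-run {r = _ ∷ []}    (refl ∷ [])       _ (nr∷ d≢d _) = d≢d refl
¬NoRepeat-run {r = _ ∷ _ ∷ _} (_ ∷ e≡d ∷ e≡ds) _ (nr∷ _ nr)  = ¬NoRepeat-run (e≡d ∷ e≡ds) (here (sym e≡d)) nr

recurrence⇒¬Alternate : ∀ {n} {d y : Fin n} {u s} → d ∈ u → y ∉ u → ¬ Alternate d y (u ++ d ∷ s)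
recurrence⇒¬Alternate {d = d} {y} {u} {s} d∈u y∉u alt = ¬NoRepeat-run onlyDs d∈r nr
  where
  P? = λ z → (z ≟ d) ⊎-dec (z ≟ y)
  onlyDs : All (_≡ d) (restrict d y u)
  onlyDs = All.tabulate λ z∈r → case ∈-filter⁻ P? {xs = u} z∈r of λ where
    (_   , inj₁ z≡d)    → z≡d
    (y∈u , inj₂ refl) → ⊥-elim (y∉u y∈u)
  d∈r : d ∈ restrict d y u
  d∈r = ∈-filter⁺ P? d∈u (inj₁ refl)
  nr : NoRepeat (restrict d y u ++ d ∷ restrict d y s)
  nr = subst NoRepeat
    (trans (restrict-++ d y u (d ∷ s)) (cong (restrict d y u ++_) (restrict-∷ˡ d y s))) alt

cyclicWord : ∀ {n} → Word n → ℕ → Word n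
cyclicWord p k = p ++ take k p

length-cyclicWord : ∀ {n} (p : Word n) {k} → k ≤ length p → length (cyclicWord p k) ≡ length p + k
length-cyclicWord p {k} k≤p =
  trans (length-++ p) (cong (length p +_) (trans (length-take k p) (m≤n⇒m⊓n≡m k≤p)))

Unique-length2 : ∀ {A : Set} (r : List A) → Unique r → length r ≡ 2 → ∃₂ λ a b → a ≢ b × r ≡ a ∷ b ∷ []
Unique-length2 (a ∷ b ∷ []) ((a≢b ∷ []) ∷ _) _ = a , b , a≢b , refl

restrict-permutation : ∀ {n} {p : Word n} → IsPermutation p → ∀ {x y} → x ≢ y →
  ∃₂ λ a b → a ≢ b × restrict x y p ≡ a ∷ b ∷ []
restrict-permutation {p = p} (up , covers) {x} {y} x≢y =
  Unique-length2 r ur (≤-antisym (Unique-⊆⇒length≤ ur r⊆xy) (Unique-⊆⇒length≤ uxy xy⊆r))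
  where
  P? = λ z → (z ≟ x) ⊎-dec (z ≟ y)
  r = restrict x y p
  ur : Unique r
  ur = Unique.filter⁺ P? up
  uxy : Unique (x ∷ y ∷ [])
  uxy = (x≢y ∷ []) ∷ [] ∷ []
  r⊆xy : r ⊆ x ∷ y ∷ []
  r⊆xy z∈r with ∈-filter⁻ P? {xs = p} z∈r
  ... | _ , inj₁ z≡x = here z≡x
  ... | _ , inj₂ z≡y = there (here z≡y)
  xy⊆r : x ∷ y ∷ [] ⊆ r
  xy⊆r (here refl)         = ∈-filter⁺ P? (covers x) (inj₁ refl)
  xy⊆r (there (here refl)) = ∈-filter⁺ P? (covers y) (inj₂ refl)

NoRepeat-pair-++-prefix : ∀ {n} {a b : Fin n} → a ≢ b → ∀ t {t′} → t ++ t′ ≡ a ∷ b ∷ [] → NoRepeat (a ∷ b ∷ t)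
NoRepeat-pair-++-prefix a≢b []              _    = nr∷ a≢b nr[ _ ]
NoRepeat-pair-++-prefix a≢b (_ ∷ [])        refl = nr∷ a≢b (nr∷ (a≢b ∘ sym) nr[ _ ])
NoRepeat-pair-++-prefix a≢b (_ ∷ _ ∷ [])    refl = nr∷ a≢b (nr∷ (a≢b ∘ sym) (nr∷ a≢b nr[ _ ]))
NoRepeat-pair-++-prefix a≢b (_ ∷ _ ∷ _ ∷ _) ()

cyclicWord-alternating : ∀ {n} {p : Word n} → IsPermutation p → ∀ k → Alternating (cyclicWord p k)
cyclicWord-alternating {p = p} perm k x y x≢y
  with a , b , a≢b , r≡ab ← restrict-permutation perm x≢y =
  subst NoRepeat (sym restrict≡) (NoRepeat-pair-++-prefix a≢b (restrict x y (take k p)) split)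
  where
  restrict≡ : restrict x y (cyclicWord p k) ≡ a ∷ b ∷ restrict x y (take k p)
  restrict≡ = trans (restrict-++ x y p (take k p)) (cong (_++ restrict x y (take k p)) r≡ab)
  split : restrict x y (take k p) ++ restrict x y (drop k p) ≡ a ∷ b ∷ []
  split = begin
    restrict x y (take k p) ++ restrict x y (drop k p) ≡⟨ restrict-++ x y (take k p) (drop k p) ⟨
    restrict x y (take k p ++ drop k p)                 ≡⟨ cong (restrict x y) (take++drop≡id k p) ⟩
    restrict x y p                                      ≡⟨ r≡ab ⟩
    a ∷ b ∷ []                                          ∎
    where open ≡-Reasoning

square-covers : ∀ {n} {X v : Word n} → X ≢ [] → Alternating (X ++ X ++ v) → ∀ y → y ∈ X
square-covers {X = []}     X≢[] _   _ = ⊥-elim (X≢[] refl)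
square-covers {X = c ∷ X′} _    alt y with y ∈? c ∷ X′
... | yes y∈X = y∈X
... | no  y∉X = ⊥-elim (recurrence⇒¬Alternate (here refl) y∉X (alt c y λ { refl → y∉X (here refl) }))

cyclicWord-squareFree : ∀ {n} {p : Word n} → IsPermutation p → ∀ {k} → k < length p →
  SquareFree (cyclicWord p k)
cyclicWord-squareFree {p = p} perm {k} k<p (u , X , v , X≢[] , w≡) = <-irrefl refl (begin-strict
  length p + length p                            ≤⟨ +-mono-≤ p≤X p≤X ⟩
  length X + length X                            ≤⟨ +-monoʳ-≤ (length X) (m≤m+n (length X) (length v)) ⟩
  length X + (length X + length v)               ≤⟨ m≤n+m _ (length u) ⟩
  length u + (length X + (length X + length v))  ≡⟨ lengthSquare ⟨
  length (u ++ X ++ X ++ v)                      ≡⟨ cong length w≡ ⟨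
  length (cyclicWord p k)                        ≡⟨ length-cyclicWord p (<⇒≤ k<p) ⟩
  length p + k                                   <⟨ +-monoʳ-< (length p) k<p ⟩
  length p + length p                            ∎)
  where
  open ≤-Reasoning
  p≤X : length p ≤ length X
  p≤X = Unique-⊆⇒length≤ (proj₁ perm) λ {y} _ → square-covers X≢[]
    (Alternating-suffix u (subst Alternating w≡ (cyclicWord-alternating perm k))) y
  lengthSquare : length (u ++ X ++ X ++ v) ≡ length u + (length X + (length X + length v))
  lengthSquare = trans (length-++ u)
    (cong (length u +_) (trans (length-++ X) (cong (length X +_) (length-++ X))))

maximalUniquePrefix-covers : ∀ {n} (p s : Word n) → (∀ x → x ∈ p ++ s) → Alternating (p ++ s) →
  (∀ {d s′} → s ≡ d ∷ s′ → d ∈ p) → ∀ x → x ∈ p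
maximalUniquePrefix-covers p s covers alt headIn y with y ∈? p | ∈-++⁻ p (covers y)
... | yes y∈p | _        = y∈p
... | no  _   | inj₁ y∈p = y∈p
maximalUniquePrefix-covers p (d ∷ s′) _ alt headIn y | no y∉p | inj₂ _ =
  ⊥-elim (recurrence⇒¬Alternate d∈p y∉p (alt d y λ { refl → y∉p d∈p }))
  where d∈p = headIn refl

IsPermutation-rotate : ∀ {n} {c : Fin n} {q} → IsPermutation (c ∷ q) → IsPermutation (q ∷ʳ c)
IsPermutation-rotate {c = c} {q} (u , covers) =
  Unique-∷ʳ (Unique.Unique[x∷xs]⇒x∉xs u) (AllPairs.tail u) , covers′
  where
  covers′ : ∀ x → x ∈ q ∷ʳ c
  covers′ x with covers x
  ... | here refl = ∈-++⁺ʳ q (here refl)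
  ... | there x∈q = ∈-++⁺ˡ x∈q

permutation-next : ∀ {n} {c d : Fin n} {q s} →
  IsPermutation (c ∷ q) → Alternating ((c ∷ q) ++ d ∷ s) → d ≡ c
permutation-next {c = c} {d} (u , covers) alt with d ≟ c | covers d
... | yes d≡c | _          = d≡c
... | no  d≢c | here d≡c   = ⊥-elim (d≢c d≡c)
... | no  d≢c | there d∈q  =
  ⊥-elim (recurrence⇒¬Alternate d∈q (Unique.Unique[x∷xs]⇒x∉xs u) (Alternating-suffix [ c ] alt d c d≢c))

periodicSuffix : ∀ {n} s {p : Word n} → 0 < length p → IsPermutation p →
  Alternating (p ++ s) → SquareFree (p ++ s) → ∃ λ k → k < length p × s ≡ take k p
periodicSuffix []      p>0 _ _ _ = 0 , p>0 , refl
periodicSuffix (d ∷ s) {c ∷ q} _ perm alt sf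
  with refl ← permutation-next perm alt
  with k , k<q∷ʳc , s≡ ← periodicSuffix s (∈-length (∈-++⁺ʳ q (here refl))) (IsPermutation-rotate perm)
         (Alternating-suffix [ c ] (subst Alternating (cong (c ∷_) (sym (∷ʳ-++ q c s))) alt))
         (SquareFree-suffix [ c ] (subst SquareFree (cong (c ∷_) (sym (∷ʳ-++ q c s))) sf))
  with m<1+n⇒m<n∨m≡n (subst (k <_) (length-∷ʳ q c) k<q∷ʳc)
... | inj₁ k<q  = suc k , s≤s k<q , cong (c ∷_) (trans s≡ (take-++ˡ q (<⇒≤ k<q)))
... | inj₂ refl = ⊥-elim (sf ([] , c ∷ q , [] , (λ ()) , cong (λ t → (c ∷ q) ++ c ∷ t) s≡q++[]))
  where
  s≡q++[] : s ≡ q ++ []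
  s≡q++[] = trans s≡ (trans (take-++ˡ q ≤-refl)
    (trans (take-all (length q) q ≤-refl) (sym (++-identityʳ q))))

IsCyclicWord : ∀ {n} → Word n → Set
IsCyclicWord w = ∃₂ λ p k → IsPermutation p × k < length p × w ≡ cyclicWord p k

Represents-Complete⇒Alternating : ∀ {n} {w : Word n} → Represents Complete w → Alternating w
Represents-Complete⇒Alternating (_ , represents) x y x≢y = proj₂ (represents x y x≢y) x≢y

squareFreeRepresentation⇔cyclicWord : ∀ {n} {w : Word (suc n)} →
  (SquareFree w × Represents Complete w) ⇔ IsCyclicWord w
squareFreeRepresentation⇔cyclicWord {w = w} = mk⇔ to from
  where
  to : SquareFree w × Represents Complete w → IsCyclicWord w
  to (sf , rep@(covers , _))
    with alt ← Represents-Complete⇒Alternating rep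
    with p , s , refl , up , headIn ← maximalUniquePrefix w
    with coversP ← maximalUniquePrefix-covers p s covers alt headIn
    with k , k<p , refl ← periodicSuffix s (∈-length (coversP zero)) (up , coversP) alt sf
    = p , k , (up , coversP) , k<p , refl
  from : IsCyclicWord w → SquareFree w × Represents Complete w
  from (p , k , perm , k<p , refl) =
      cyclicWord-squareFree perm k<p
    , (λ x → ∈-++⁺ˡ (proj₂ perm x))
    , λ x y x≢y → (λ _ → x≢y) , (λ _ → cyclicWord-alternating perm k x y x≢y)

cyclicWords : ∀ n → List (Word n)
cyclicWords n = map (uncurry cyclicWord) (cartesianProduct (permutations n) (upTo n))

∈-cyclicWords⇔ : ∀ {n} {w : Word n} → w ∈ cyclicWords n ⇔ IsCyclicWord w
∈-cyclicWords⇔ {n} = mk⇔ to from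
  where
  to : ∀ {w} → w ∈ cyclicWords n → IsCyclicWord w
  to w∈ with (p , k) , pk∈ , refl ← ∈-map⁻ (uncurry cyclicWord) w∈
        with p∈ , k∈ ← ∈-cartesianProduct⁻ (permutations n) (upTo n) pk∈
        with perm ← Equivalence.to ∈-permutations⇔ p∈
    = p , k , perm , subst (k <_) (sym (IsPermutation⇒length≡ perm)) (∈-upTo⁻ k∈) , refl
  from : ∀ {w} → IsCyclicWord w → w ∈ cyclicWords n
  from (p , k , perm , k<p , refl) = ∈-map⁺ (uncurry cyclicWord) (∈-cartesianProduct⁺
    (Equivalence.from ∈-permutations⇔ perm) (∈-upTo⁺ (subst (k <_) (IsPermutation⇒length≡ perm) k<p)))

Unique-cyclicWords : ∀ n → Unique (cyclicWords n)
Unique-cyclicWords n =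
  Unique-map⁺-∈ injective (Unique.cartesianProduct⁺ (Unique-permutations n) (Unique.upTo⁺ n))
  where
  injective : ∀ {pk ql : Word n × ℕ} → pk ∈ cartesianProduct (permutations n) (upTo n) →
    ql ∈ cartesianProduct (permutations n) (upTo n) → uncurry cyclicWord pk ≡ uncurry cyclicWord ql → pk ≡ ql
  injective {p , k} {q , l} pk∈ ql∈ eq
    with p∈ , k∈ ← ∈-cartesianProduct⁻ (permutations n) (upTo n) pk∈
    with q∈ , l∈ ← ∈-cartesianProduct⁻ (permutations n) (upTo n) ql∈
    with refl ← ++-cancelˡ-length p q
                  (trans (∈-permutations⇒length≡ p∈) (sym (∈-permutations⇒length≡ q∈))) eq
    = cong (p ,_) (begin
      k                    ≡⟨ length-take≡ k∈ p∈ ⟨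
      length (take k p)    ≡⟨ cong length (++-cancelˡ p (take k p) (take l p) eq) ⟩
      length (take l p)    ≡⟨ length-take≡ l∈ p∈ ⟩
      l                    ∎)
    where
    open ≡-Reasoning
    length-take≡ : ∀ {k p} → k ∈ upTo n → p ∈ permutations n → length (take k p) ≡ k
    length-take≡ {k} {p} k∈ p∈ = trans (length-take k p)
      (m≤n⇒m⊓n≡m (<⇒≤ (subst (k <_) (sym (∈-permutations⇒length≡ p∈)) (∈-upTo⁻ k∈))))

length-cyclicWords : ∀ n → length (cyclicWords n) ≡ n * n !
length-cyclicWords n = begin
  length (cyclicWords n)                     ≡⟨ length-map _ pairs ⟩
  length pairs                               ≡⟨ length-cartesianProduct (permutations n) (upTo n) ⟩
  length (permutations n) * length (upTo n)  ≡⟨ cong₂ _*_ (length-permutations n) (length-upTo n) ⟩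
  n ! * n                                    ≡⟨ *-comm (n !) n ⟩
  n * n !                                    ∎
  where
  open ≡-Reasoning
  pairs = cartesianProduct (permutations n) (upTo n)

mainTheorem9 : (n : ℕ) → 1 ≤ n →
    Σ (List (Word n)) (λ ws →
    Unique ws × length ws ≡ n * (n !) ×
    ((w : Word n) → w ∈ ws ⇔ (SquareFree w × Represents Complete w)))
mainTheorem9 (suc n) _ = cyclicWords (suc n) , Unique-cyclicWords (suc n) , length-cyclicWords (suc n) ,
  λ w → ⇔.trans ∈-cyclicWords⇔ (⇔.sym squareFreeRepresentation⇔cyclicWord)
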